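{- Let $G$ be a connected bipartite simple graph with bipartition $(V_1,V_2)$ and edge cone $\mathbb{R}_+\mathcal{A}$, and let $F=H_A\cap\mathbb{R}_+\mathcal{A}$ be a facet of $\mathbb{R}_+\mathcal{A}$ with $A\subsetneq V_1$. Then: (a) If $N(A)=V_2$, then $A=V_1\setminus\{v_i\}$ for some $v_i\in V_1$ and $F=H_{e_i}\cap\mathbb{R}_+\mathcal{A}$. (b) If $N(A)\subsetneq V_2$, then $F=H_{V_2\setminus N(A)}\cap\mathbb{R}_+\mathcal{A}$ and $N(V_2\setminus N(A))=V_1\setminus A$.
   Context: Let $V(G)=\{v_1,\ldots,v_n\}$ and $e_i$ the $i$-th unit vector of $\mathbb{R}^n$; $H_{e_i}=\{x\mid x_i=0\}$. The edge cone $\mathbb{R}_+\mathcal{A}$ is the cone of nonnegative real combinations of the vectors $e_i+e_j$ with $\{v_i,v_j\}$ an edge of $G$. $N(B)$ is the set of vertices adjacent to some vertex of $B$; for $B\subset V_1$ or $B\subset V_2$, $H_B=\{x\mid\sum_{v_i\in B}x_i=\sum_{v_i\in N(B)}x_i\}$. A facet of a cone $Q$ is a set $Q\cap H$, $H$ a hyperplane through the origin with $Q$ on one side, of dimension $\dim Q-1$.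
   Formalization: The edge cone, the hyperplanes and the dimensions are taken over ℚ rather than ℝ, so points and normal vectors have rational coordinates and linear independence is over ℚ. -}

module Defs where

open import Data.Nat using (ℕ; zero; suc)
open import Data.Fin using (Fin; zero; suc; _≟_)
open import Data.Bool using (Bool; true; false; not; _∧_; _∨_; if_then_else_)
open import Data.Rational using (ℚ; 0ℚ; 1ℚ; _+_; _*_; _-_; _≤_)
open import Data.Product using (Σ; ∃; _×_; _,_)
open import Data.Sum using (_⊎_)
open import Relation.Nullary using (¬_; does)
open import Relation.Binary.PropositionalEquality using (_≡_)

-- Vertices of G are v_0,…,v_{n-1}, i.e. elements of Fin n.
-- A simple graph: a symmetric irreflexive Boolean adjacency relation.
record Graph (n : ℕ) : Set where
  field
    adj     : Fin n → Fin n → Bool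
    symm    : ∀ i j → adj i j ≡ adj j i
    irrefl  : ∀ i → adj i i ≡ false
open Graph public

VSet : ℕ → Set
VSet n = Fin n → Bool

_∈ᵥ_ : ∀ {n} → Fin n → VSet n → Set
i ∈ᵥ B = B i ≡ true

_≐ᵥ_ : ∀ {n} → VSet n → VSet n → Set
A ≐ᵥ B = ∀ i → A i ≡ B i

_⊆ᵥ_ : ∀ {n} → VSet n → VSet n → Set
A ⊆ᵥ B = ∀ i → i ∈ᵥ A → i ∈ᵥ B

_⊊ᵥ_ : ∀ {n} → VSet n → VSet n → Set
A ⊊ᵥ B = A ⊆ᵥ B × ∃ λ i → (i ∈ᵥ B) × (A i ≡ false)

complᵥ : ∀ {n} → VSet n → VSet n
complᵥ A i = not (A i)

_∖ᵥ_ : ∀ {n} → VSet n → VSet n → VSet n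
(A ∖ᵥ B) i = A i ∧ not (B i)

singleᵥ : ∀ {n} → Fin n → VSet n
singleᵥ i j = does (i ≟ j)

anyFin : ∀ {n} → (Fin n → Bool) → Bool
anyFin {zero}  f = false
anyFin {suc n} f = f zero ∨ anyFin (λ i → f (suc i))

N : ∀ {n} → Graph n → VSet n → VSet n
N G B j = anyFin (λ i → B i ∧ adj G i j)

data Reach {n} (G : Graph n) : Fin n → Fin n → Set where
  here : ∀ {u} → Reach G u u
  step : ∀ {u v w} → adj G u v ≡ true → Reach G v w → Reach G u w

Connected : ∀ {n} → Graph n → Set
Connected G = ∀ u v → Reach G u v

-- (V1, V2) with V2 = complement of V1 is a bipartition of G:
-- every edge joins a vertex of V1 to a vertex of V2.
IsBipartition : ∀ {n} → Graph n → VSet n → Set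
IsBipartition G V1 = ∀ i j → adj G i j ≡ true → V1 i ≡ not (V1 j)

Vecℚ : ℕ → Set
Vecℚ n = Fin n → ℚ

sumFin : ∀ {n} → (Fin n → ℚ) → ℚ
sumFin {zero}  f = 0ℚ
sumFin {suc n} f = f zero + sumFin (λ i → f (suc i))

unit : ∀ {n} → Fin n → Vecℚ n
unit i k = if does (i ≟ k) then 1ℚ else 0ℚ

VPred : ℕ → Set₁
VPred n = Vecℚ n → Set

_∩_ : ∀ {n} → VPred n → VPred n → VPred n
(P ∩ Q) x = P x × Q x

_≐_ : ∀ {n} → VPred n → VPred n → Set
P ≐ Q = ∀ x → (P x → Q x) × (Q x → P x)

_⊆_ : ∀ {n} → VPred n → VPred n → Set
P ⊆ Q = ∀ x → P x → Q x

EdgeCone : ∀ {n} → Graph n → VPred n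
EdgeCone {n} G x =
  Σ (Fin n → Fin n → ℚ) λ c →
    (∀ i j → 0ℚ ≤ c i j) ×
    (∀ i j → adj G i j ≡ false → c i j ≡ 0ℚ) ×
    (∀ k → x k ≡ sumFin (λ i → sumFin (λ j → c i j * (unit i k + unit j k))))

LinIndep : ∀ {n k} → (Fin k → Vecℚ n) → Set
LinIndep {n} {k} v =
  ∀ (c : Fin k → ℚ) → (∀ t → sumFin (λ j → c j * v j t) ≡ 0ℚ) → ∀ j → c j ≡ 0ℚ

HasDim : ∀ {n} → VPred n → ℕ → Set
HasDim {n} S d =
  (Σ (Fin d → Vecℚ n) λ v → (∀ j → S (v j)) × LinIndep v) ×
  (∀ (v : Fin (suc d) → Vecℚ n) → (∀ j → S (v j)) → ¬ LinIndep v)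

dot : ∀ {n} → Vecℚ n → Vecℚ n → ℚ
dot a x = sumFin (λ i → a i * x i)

HypPlane : ∀ {n} → Vecℚ n → VPred n
HypPlane a x = dot a x ≡ 0ℚ

IsFacet : ∀ {n} → VPred n → VPred n → Set
IsFacet {n} Q F =
  (Σ (Vecℚ n) λ a →
     (∃ λ i → ¬ (a i ≡ 0ℚ)) ×
     ((∀ x → Q x → 0ℚ ≤ dot a x) ⊎ (∀ x → Q x → dot a x ≤ 0ℚ)) ×
     (F ≐ (Q ∩ HypPlane a))) ×
  (∃ λ d → HasDim Q (suc d) × HasDim F d)

He : ∀ {n} → Fin n → VPred n
He i x = x i ≡ 0ℚ

sumOver : ∀ {n} → VSet n → Vecℚ n → ℚ
sumOver B x = sumFin (λ i → if B i then x i else 0ℚ)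

HB : ∀ {n} → Graph n → VSet n → VPred n
HB G B x = sumOver B x ≡ sumOver (N G B) x

{-# OPTIONS --safe #-}
-- Let g = 1_{N(A)} − 1_A be the normal of H_A. On an edge {v_i, v_j} with v_i ∈ V1,
-- g_i + g_j = [v_j ∈ N(A)] − [v_i ∈ A] ≥ 0, so points of F only use edges on which g vanishes.
-- If u ∈ V1 ∖ A has all its neighbours in N(A), then g is 1 on every edge at u and F ⊆ H_{e_u}.
-- As F is a facet, every functional vanishing on F is then dependent on e_u over the cone, so it
-- vanishes on every edge avoiding u. In (a) this excludes a second vertex of V1 ∖ A; in (b) it
-- excludes a vertex of V1 ∖ A outside N(V2 ∖ N(A)), since a walk from such a vertex to V2 ∖ N(A)
-- crosses an edge from N(A) into V1 ∖ A, where g is 1. In both cases g then agrees on every edge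
-- with the normal of the claimed hyperplane, so the two hyperplanes cut the same face from the cone.
module Submission where

open import Defs
open import Algebra.Bundles using (CommutativeRing)
open import Data.Bool using (Bool; true; false; not; _∧_; _∨_; if_then_else_)
open import Data.Bool.Properties using (∧-conicalˡ; ∧-conicalʳ; ∨-conicalˡ; ∨-conicalʳ; not-injective; not-involutive; not-¬; ¬-not)
open import Data.Empty using (⊥; ⊥-elim)
open import Data.Fin using (Fin; zero; suc; _≟_)
open import Data.Nat using (ℕ; zero; suc)
open import Data.Product using (∃; ∃₂; _×_; _,_; proj₁; proj₂)
open import Data.Rational using (ℚ; 0ℚ; 1ℚ; _+_; _*_; _-_; -_; _≤_; 1/_; ≢-nonZero; nonNegative)
open import Data.Rational.Properties
  using (+-0-group; +-*-commutativeRing; +-identityˡ; +-identityʳ; +-comm; +-mono-≤; +-monoʳ-≤;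
         *-identityˡ; *-identityʳ; *-zeroˡ; *-zeroʳ; *-comm; *-assoc; *-distribˡ-+; *-inverseʳ; neg-distrib-+;
         ≤-refl; ≤-reflexive; ≤-antisym; nonNegative⁻¹; nonNeg*nonNeg⇒nonNeg)
  renaming (_≟_ to _≟ℚ_)
open import Data.Rational.Solver using (module +-*-Solver)
open import Data.Vec.Functional using (_∷_)
open import Function using (_∘_)
open import Relation.Nullary using (does; yes; no)
open import Relation.Nullary.Decidable using (dec-true; dec-false; decidable-stable)
open import Relation.Binary.PropositionalEquality
  using (_≡_; _≢_; refl; sym; trans; cong; cong₂; subst; subst₂; module ≡-Reasoning)

open import Algebra.Properties.Semiring.Sum (CommutativeRing.semiring +-*-commutativeRing)
  using (sum; ∑-distrib-+; ∑-comm; *-distribˡ-sum)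
open import Algebra.Properties.Group +-0-group using (x∙y⁻¹≈ε⇒x≈y; x≈y⇒x∙y⁻¹≈ε)
open +-*-Solver using (solve; con; _:+_; _:*_; _:-_; _:=_)
open ≡-Reasoning

sumFin≡sum : ∀ {n} (f : Fin n → ℚ) → sumFin f ≡ sum f
sumFin≡sum {zero}  f = refl
sumFin≡sum {suc n} f = cong (f zero +_) (sumFin≡sum (f ∘ suc))

sumFin-cong : ∀ {n} {f g : Fin n → ℚ} → (∀ i → f i ≡ g i) → sumFin f ≡ sumFin g
sumFin-cong {zero}  f≗g = refl
sumFin-cong {suc n} f≗g = cong₂ _+_ (f≗g zero) (sumFin-cong (f≗g ∘ suc))

sumFin-zero : ∀ {n} {f : Fin n → ℚ} → (∀ i → f i ≡ 0ℚ) → sumFin f ≡ 0ℚ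
sumFin-zero {zero}  f≗0 = refl
sumFin-zero {suc n} f≗0 = cong₂ _+_ (f≗0 zero) (sumFin-zero (f≗0 ∘ suc))

sumFin-+ : ∀ {n} (f g : Fin n → ℚ) → sumFin (λ i → f i + g i) ≡ sumFin f + sumFin g
sumFin-+ f g = begin
  sumFin (λ i → f i + g i) ≡⟨ sumFin≡sum (λ i → f i + g i) ⟩
  sum (λ i → f i + g i)    ≡⟨ ∑-distrib-+ f g ⟩
  sum f + sum g            ≡⟨ sym (cong₂ _+_ (sumFin≡sum f) (sumFin≡sum g)) ⟩
  sumFin f + sumFin g      ∎

*-distribˡ-sumFin : ∀ {n} a (f : Fin n → ℚ) → a * sumFin f ≡ sumFin (λ i → a * f i)
*-distribˡ-sumFin a f = begin
  a * sumFin f             ≡⟨ cong (a *_) (sumFin≡sum f) ⟩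
  a * sum f                ≡⟨ *-distribˡ-sum a f ⟩
  sum (λ i → a * f i)      ≡⟨ sym (sumFin≡sum (λ i → a * f i)) ⟩
  sumFin (λ i → a * f i)   ∎

sumFin-comm : ∀ {m n} (f : Fin m → Fin n → ℚ) →
  sumFin (λ i → sumFin (f i)) ≡ sumFin (λ j → sumFin (λ i → f i j))
sumFin-comm f = begin
  sumFin (λ i → sumFin (f i))          ≡⟨ sumFin²≡sum² f ⟩
  sum (λ i → sum (f i))                ≡⟨ ∑-comm f ⟩
  sum (λ j → sum (λ i → f i j))        ≡⟨ sym (sumFin²≡sum² (λ j i → f i j)) ⟩
  sumFin (λ j → sumFin (λ i → f i j))  ∎
  where
  sumFin²≡sum² : ∀ {m n} (h : Fin m → Fin n → ℚ) → sumFin (λ i → sumFin (h i)) ≡ sum (λ i → sum (h i))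
  sumFin²≡sum² h = trans (sumFin-cong (sumFin≡sum ∘ h)) (sumFin≡sum (λ i → sum (h i)))

sumFin-neg : ∀ {n} (f : Fin n → ℚ) → sumFin (λ i → - f i) ≡ - sumFin f
sumFin-neg {zero}  f = refl
sumFin-neg {suc n} f =
  trans (cong (- f zero +_) (sumFin-neg (f ∘ suc))) (sym (neg-distrib-+ (f zero) (sumFin (f ∘ suc))))

sumFin-- : ∀ {n} (f g : Fin n → ℚ) → sumFin (λ i → f i - g i) ≡ sumFin f - sumFin g
sumFin-- f g = trans (sumFin-+ f (λ i → - g i)) (cong (sumFin f +_) (sumFin-neg g))

nonNeg+nonNeg≡0 : ∀ {a b} → 0ℚ ≤ a → 0ℚ ≤ b → a + b ≡ 0ℚ → a ≡ 0ℚ × b ≡ 0ℚ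
nonNeg+nonNeg≡0 {a} {b} 0≤a 0≤b a+b≡0 = ≤-antisym a≤0 0≤a , ≤-antisym b≤0 0≤b
  where
  a≤0 : a ≤ 0ℚ
  a≤0 = subst₂ _≤_ (+-identityʳ a) a+b≡0 (+-monoʳ-≤ a 0≤b)
  b≤0 : b ≤ 0ℚ
  b≤0 = subst₂ _≤_ (+-identityʳ b) (trans (+-comm b a) a+b≡0) (+-monoʳ-≤ b 0≤a)

sumFin-nonNeg : ∀ {n} {f : Fin n → ℚ} → (∀ i → 0ℚ ≤ f i) → 0ℚ ≤ sumFin f
sumFin-nonNeg {zero}  0≤f = ≤-refl
sumFin-nonNeg {suc n} 0≤f = +-mono-≤ (0≤f zero) (sumFin-nonNeg (0≤f ∘ suc))

sumFin-nonNeg≡0 : ∀ {n} {f : Fin n → ℚ} → (∀ i → 0ℚ ≤ f i) → sumFin f ≡ 0ℚ → ∀ i → f i ≡ 0ℚ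
sumFin-nonNeg≡0 {suc n} 0≤f Σf≡0 zero    = proj₁ (nonNeg+nonNeg≡0 (0≤f zero) (sumFin-nonNeg (0≤f ∘ suc)) Σf≡0)
sumFin-nonNeg≡0 {suc n} 0≤f Σf≡0 (suc i) =
  sumFin-nonNeg≡0 (0≤f ∘ suc) (proj₂ (nonNeg+nonNeg≡0 (0≤f zero) (sumFin-nonNeg (0≤f ∘ suc)) Σf≡0)) i

p*q≡0⇒p≡0 : ∀ p {q} → q ≢ 0ℚ → p * q ≡ 0ℚ → p ≡ 0ℚ
p*q≡0⇒p≡0 p {q} q≢0 pq≡0 = begin
  p                  ≡⟨ sym (*-identityʳ p) ⟩
  p * 1ℚ             ≡⟨ cong (p *_) (sym (*-inverseʳ q)) ⟩
  p * (q * (1/ q))   ≡⟨ sym (*-assoc p q (1/ q)) ⟩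
  (p * q) * (1/ q)   ≡⟨ cong (_* (1/ q)) pq≡0 ⟩
  0ℚ * (1/ q)        ≡⟨ *-zeroˡ (1/ q) ⟩
  0ℚ                 ∎
  where instance _ = ≢-nonZero q≢0

p≡1⇒p≢0 : ∀ {p} → p ≡ 1ℚ → p ≢ 0ℚ
p≡1⇒p≢0 refl ()

p≡0⇒p*q≡0 : ∀ {p} q → p ≡ 0ℚ → p * q ≡ 0ℚ
p≡0⇒p*q≡0 q refl = *-zeroˡ q

ind : Bool → ℚ
ind b = if b then 1ℚ else 0ℚ

unit-≢ : ∀ {n} {u k : Fin n} → u ≢ k → unit u k ≡ 0ℚ
unit-≢ {u = u} {k} u≢k = cong ind (dec-false (u ≟ k) u≢k)

unit-refl : ∀ {n} (u : Fin n) → unit u u ≡ 1ℚ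
unit-refl u = cong ind (dec-true (u ≟ u) refl)

ind-nonNeg : ∀ b → 0ℚ ≤ ind b
ind-nonNeg true  = nonNegative⁻¹ 1ℚ
ind-nonNeg false = ≤-refl

sumFin-unit : ∀ {n} (u : Fin n) (h : Fin n → ℚ) → sumFin (λ i → unit u i * h i) ≡ h u
sumFin-unit zero h =
  trans (cong₂ _+_ (*-identityˡ (h zero)) (sumFin-zero (λ i → *-zeroˡ (h (suc i))))) (+-identityʳ (h zero))
sumFin-unit (suc u) h =
  trans (cong₂ _+_ (*-zeroˡ (h zero)) (sumFin-unit u (h ∘ suc))) (+-identityˡ (h (suc u)))

dot-congʳ : ∀ {n} (g : Vecℚ n) {x y : Vecℚ n} → (∀ k → x k ≡ y k) → dot g x ≡ dot g y
dot-congʳ g x≗y = sumFin-cong (λ k → cong (g k *_) (x≗y k))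

dot-zeroʳ : ∀ {n} (g : Vecℚ n) {x : Vecℚ n} → (∀ k → x k ≡ 0ℚ) → dot g x ≡ 0ℚ
dot-zeroʳ g x≗0 = trans (dot-congʳ g x≗0) (sumFin-zero (λ k → *-zeroʳ (g k)))

dot-unitˡ : ∀ {n} (u : Fin n) (x : Vecℚ n) → dot (unit u) x ≡ x u
dot-unitˡ = sumFin-unit

dot-unitʳ : ∀ {n} (g : Vecℚ n) (u : Fin n) → dot g (unit u) ≡ g u
dot-unitʳ g u = trans (sumFin-cong (λ k → *-comm (g k) (unit u k))) (sumFin-unit u g)

dot-+ʳ : ∀ {n} (g x y : Vecℚ n) → dot g (λ k → x k + y k) ≡ dot g x + dot g y
dot-+ʳ g x y = trans (sumFin-cong (λ k → *-distribˡ-+ (g k) (x k) (y k))) (sumFin-+ (λ k → g k * x k) (λ k → g k * y k))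

dot-*ʳ : ∀ {n} (g : Vecℚ n) (a : ℚ) (x : Vecℚ n) → dot g (λ k → a * x k) ≡ a * dot g x
dot-*ʳ g a x = begin
  sumFin (λ k → g k * (a * x k))   ≡⟨ sumFin-cong (λ k → x*[y*z]≡y*[x*z] (g k) a (x k)) ⟩
  sumFin (λ k → a * (g k * x k))   ≡⟨ sym (*-distribˡ-sumFin a (λ k → g k * x k)) ⟩
  a * dot g x                      ∎
  where
  x*[y*z]≡y*[x*z] : ∀ x y z → x * (y * z) ≡ y * (x * z)
  x*[y*z]≡y*[x*z] = solve 3 (λ x y z → x :* (y :* z) := y :* (x :* z)) refl

dot-sumʳ : ∀ {n m} (g : Vecℚ n) (v : Fin m → Vecℚ n) →
  dot g (λ k → sumFin (λ j → v j k)) ≡ sumFin (λ j → dot g (v j))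
dot-sumʳ g v = trans (sumFin-cong (λ k → *-distribˡ-sumFin (g k) (λ j → v j k)))
                     (sumFin-comm (λ k j → g k * v j k))

dot-lincombʳ : ∀ {n m} (g : Vecℚ n) (c : Fin m → ℚ) (v : Fin m → Vecℚ n) →
  dot g (λ k → sumFin (λ j → c j * v j k)) ≡ sumFin (λ j → c j * dot g (v j))
dot-lincombʳ g c v = trans (dot-sumʳ g (λ j k → c j * v j k)) (sumFin-cong (λ j → dot-*ʳ g (c j) (v j)))

LinIndep-∷ : ∀ {n m} (g y : Vecℚ n) {w : Fin m → Vecℚ n} → LinIndep w →
  (∀ j → dot g (w j) ≡ 0ℚ) → dot g y ≢ 0ℚ → LinIndep (y ∷ w)
LinIndep-∷ g y {w} w-indep g⊥w gy≢0 c Σcv≡0 = coefficients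
  where
  Σc′w : ℚ
  Σc′w = sumFin (λ j → c (suc j) * dot g (w j))

  c₀≡0 : c zero ≡ 0ℚ
  c₀≡0 = p*q≡0⇒p≡0 (c zero) gy≢0 (begin
    c zero * dot g y              ≡⟨ sym (+-identityʳ _) ⟩
    c zero * dot g y + 0ℚ         ≡⟨ cong (c zero * dot g y +_) (sym (sumFin-zero
                                       (λ j → trans (cong (c (suc j) *_) (g⊥w j)) (*-zeroʳ (c (suc j)))))) ⟩
    c zero * dot g y + Σc′w       ≡⟨ sym (dot-lincombʳ g c (y ∷ w)) ⟩
    dot g (λ k → sumFin (λ j → c j * (y ∷ w) j k)) ≡⟨ dot-zeroʳ g Σcv≡0 ⟩
    0ℚ                            ∎)

  Σc′w≡0 : ∀ k → sumFin (λ j → c (suc j) * w j k) ≡ 0ℚ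
  Σc′w≡0 k = begin
    sumFin (λ j → c (suc j) * w j k)             ≡⟨ sym (+-identityˡ _) ⟩
    0ℚ + sumFin (λ j → c (suc j) * w j k)        ≡⟨ cong (_+ _) (sym (trans (cong (_* y k) c₀≡0) (*-zeroˡ (y k)))) ⟩
    c zero * y k + sumFin (λ j → c (suc j) * w j k) ≡⟨ Σcv≡0 k ⟩
    0ℚ                                           ∎

  coefficients : ∀ j → c j ≡ 0ℚ
  coefficients zero    = c₀≡0
  coefficients (suc j) = w-indep (c ∘ suc) Σc′w≡0 j

-- y and z witness that g and h are independent on Q; a basis of F extended by z and then y
-- would be d + 2 independent vectors in Q.
facet-normals-dependent : ∀ {n d} {Q F : VPred n} → F ⊆ Q → HasDim Q (suc d) → HasDim F d →
  (g h : Vecℚ n) → (∀ x → F x → dot g x ≡ 0ℚ) → (∀ x → F x → dot h x ≡ 0ℚ) →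
  ∀ {y z} → Q y → Q z → dot g y ≢ 0ℚ → dot g z ≡ 0ℚ → dot h z ≢ 0ℚ → ⊥
facet-normals-dependent {Q = Q} F⊆Q (_ , no-larger-family) ((w , w∈F , w-indep) , _)
                        g h g⊥F h⊥F {y} {z} y∈Q z∈Q gy≢0 gz≡0 hz≢0 =
  no-larger-family (y ∷ z ∷ w) family∈Q
    (LinIndep-∷ g y (LinIndep-∷ h z w-indep (λ j → h⊥F _ (w∈F j)) hz≢0) g⊥z∷w gy≢0)
  where
  family∈Q : ∀ j → Q ((y ∷ z ∷ w) j)
  family∈Q zero          = y∈Q
  family∈Q (suc zero)    = z∈Q
  family∈Q (suc (suc j)) = F⊆Q _ (w∈F j)

  g⊥z∷w : ∀ j → dot g ((z ∷ w) j) ≡ 0ℚ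
  g⊥z∷w zero    = gz≡0
  g⊥z∷w (suc j) = g⊥F _ (w∈F j)

anyFin-intro : ∀ {n} (f : Fin n → Bool) i → f i ≡ true → anyFin f ≡ true
anyFin-intro f zero    fi≡true rewrite fi≡true = refl
anyFin-intro f (suc i) fi≡true with f zero
... | true  = refl
... | false = anyFin-intro (f ∘ suc) i fi≡true

anyFin-elim : ∀ {n} (f : Fin n → Bool) → anyFin f ≡ true → ∃ λ i → f i ≡ true
anyFin-elim {suc n} f any≡true with f zero in f₀≡true
... | true  = zero , f₀≡true
... | false with anyFin-elim (f ∘ suc) any≡true
...   | i , fi≡true = suc i , fi≡true

N-intro : ∀ {n} (G : Graph n) (B : VSet n) {i j} → B i ≡ true → adj G i j ≡ true → N G B j ≡ true
N-intro G B {i} {j} i∈B ij = anyFin-intro (λ k → B k ∧ adj G k j) i (cong₂ _∧_ i∈B ij)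

N-elim : ∀ {n} (G : Graph n) (B : VSet n) {j} → N G B j ≡ true → ∃ λ i → B i ≡ true × adj G i j ≡ true
N-elim G B {j} j∈NB with anyFin-elim (λ k → B k ∧ adj G k j) j∈NB
... | i , i∈B∧ij = i , ∧-conicalˡ _ _ i∈B∧ij , ∧-conicalʳ _ _ i∈B∧ij

adj⇒≢ : ∀ {n} (G : Graph n) {u v} → adj G u v ≡ true → u ≢ v
adj⇒≢ G {u} uv refl with () ← trans (sym uv) (irrefl G u)

Reach-neighbour : ∀ {n} {G : Graph n} {u w} → Reach G u w → u ≢ w → ∃ λ j → adj G u j ≡ true
Reach-neighbour here             u≢u = ⊥-elim (u≢u refl)
Reach-neighbour (step {v = v} uv _) _ = v , uv

Reach-exit : ∀ {n} {G : Graph n} (P : VSet n) {u w} → Reach G u w → P u ≡ true → P w ≡ false →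
  ∃₂ λ s t → adj G s t ≡ true × P s ≡ true × P t ≡ false
Reach-exit P here Pu Pw with () ← trans (sym Pu) Pw
Reach-exit P {u} (step {v = v} uv v⇝w) Pu Pw with P v in Pv
... | true  = Reach-exit P v⇝w Pv Pw
... | false = u , v , uv , Pu , Pv

edgeVec : ∀ {n} → Fin n → Fin n → Vecℚ n
edgeVec u w k = unit u k + unit w k

dot-edgeVec : ∀ {n} (g : Vecℚ n) (u w : Fin n) → dot g (edgeVec u w) ≡ g u + g w
dot-edgeVec g u w = trans (dot-+ʳ g (unit u) (unit w)) (cong₂ _+_ (dot-unitʳ g u) (dot-unitʳ g w))

dot-unit-edgeVec : ∀ {n} {u w : Fin n} → u ≢ w → dot (unit u) (edgeVec u w) ≡ 1ℚ
dot-unit-edgeVec {u = u} {w} u≢w =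
  trans (dot-edgeVec (unit u) u w) (trans (cong₂ _+_ (unit-refl u) (unit-≢ u≢w)) (+-identityʳ 1ℚ))

dot-unit-edgeVec-avoiding : ∀ {n} {u s t : Fin n} → u ≢ s → u ≢ t → dot (unit u) (edgeVec s t) ≡ 0ℚ
dot-unit-edgeVec-avoiding {u = u} {s} {t} u≢s u≢t =
  trans (dot-edgeVec (unit u) s t) (trans (cong₂ _+_ (unit-≢ u≢s) (unit-≢ u≢t)) (+-identityʳ 0ℚ))

edgeVec∈EdgeCone : ∀ {n} (G : Graph n) {u w} → adj G u w ≡ true → EdgeCone G (edgeVec u w)
edgeVec∈EdgeCone G {u} {w} uw = c , c-nonNeg , c-off , edgeVec≡Σc
  where
  c : Fin _ → Fin _ → ℚ
  c i j = unit u i * unit w j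

  c-nonNeg : ∀ i j → 0ℚ ≤ c i j
  c-nonNeg i j = nonNegative⁻¹ (c i j)
    {{nonNeg*nonNeg⇒nonNeg (unit u i) {{nonNegative (ind-nonNeg (does (u ≟ i)))}} (unit w j) {{nonNegative (ind-nonNeg (does (w ≟ j)))}}}}

  c-off : ∀ i j → adj G i j ≡ false → c i j ≡ 0ℚ
  c-off i j ij with u ≟ i
  ... | no _ = *-zeroˡ (unit w j)
  ... | yes refl with w ≟ j
  ...   | no _     = *-zeroʳ 1ℚ
  ...   | yes refl with () ← trans (sym uw) ij

  edgeVec≡Σc : ∀ k → edgeVec u w k ≡ sumFin (λ i → sumFin (λ j → c i j * edgeVec i j k))
  edgeVec≡Σc k = sym (begin
    sumFin (λ i → sumFin (λ j → c i j * edgeVec i j k))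
      ≡⟨ sumFin-cong (λ i → trans (sumFin-cong (λ j → *-assoc (unit u i) (unit w j) _))
                                  (sym (*-distribˡ-sumFin (unit u i) (λ j → unit w j * edgeVec i j k)))) ⟩
    sumFin (λ i → unit u i * sumFin (λ j → unit w j * edgeVec i j k))
      ≡⟨ sumFin-cong (λ i → cong (unit u i *_) (sumFin-unit w (λ j → edgeVec i j k))) ⟩
    sumFin (λ i → unit u i * edgeVec i w k)
      ≡⟨ sumFin-unit u (λ i → edgeVec i w k) ⟩
    edgeVec u w k ∎)

dot-edgeCombination : ∀ {n} (g : Vecℚ n) (c : Fin n → Fin n → ℚ) {x : Vecℚ n} →
  (∀ k → x k ≡ sumFin (λ i → sumFin (λ j → c i j * edgeVec i j k))) →
  dot g x ≡ sumFin (λ i → sumFin (λ j → c i j * (g i + g j)))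
dot-edgeCombination g c {x} x≡Σc = begin
  dot g x
    ≡⟨ dot-congʳ g x≡Σc ⟩
  dot g (λ k → sumFin (λ i → sumFin (λ j → c i j * edgeVec i j k)))
    ≡⟨ dot-sumʳ g (λ i k → sumFin (λ j → c i j * edgeVec i j k)) ⟩
  sumFin (λ i → dot g (λ k → sumFin (λ j → c i j * edgeVec i j k)))
    ≡⟨ sumFin-cong (λ i → dot-lincombʳ g (c i) (edgeVec i)) ⟩
  sumFin (λ i → sumFin (λ j → c i j * dot g (edgeVec i j)))
    ≡⟨ sumFin-cong (λ i → sumFin-cong (λ j → cong (c i j *_) (dot-edgeVec g i j))) ⟩
  sumFin (λ i → sumFin (λ j → c i j * (g i + g j)))
    ∎

EdgeCone-dot-cong : ∀ {n} (G : Graph n) (g h : Vecℚ n) {x : Vecℚ n} →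
  (∀ {i j} → adj G i j ≡ true → g i + g j ≡ h i + h j) → EdgeCone G x → dot g x ≡ dot h x
EdgeCone-dot-cong G g h {x} g≈h (c , _ , c-off , x≡Σc) = begin
  dot g x                                             ≡⟨ dot-edgeCombination g c x≡Σc ⟩
  sumFin (λ i → sumFin (λ j → c i j * (g i + g j)))   ≡⟨ sumFin-cong (λ i → sumFin-cong (term i)) ⟩
  sumFin (λ i → sumFin (λ j → c i j * (h i + h j)))   ≡⟨ sym (dot-edgeCombination h c x≡Σc) ⟩
  dot h x                                             ∎
  where
  term : ∀ i j → c i j * (g i + g j) ≡ c i j * (h i + h j)
  term i j with adj G i j in ij
  ... | true  = cong (c i j *_) (g≈h ij)
  ... | false = trans (p≡0⇒p*q≡0 (g i + g j) (c-off i j ij)) (sym (p≡0⇒p*q≡0 (h i + h j) (c-off i j ij)))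

-- Each term c i j * (g i + g j) of dot g x is nonnegative, hence zero, so no edge at u carries weight.
EdgeCone-coordinate≡0 : ∀ {n} (G : Graph n) (g : Vecℚ n) {x : Vecℚ n} → EdgeCone G x →
  (∀ {i j} → adj G i j ≡ true → 0ℚ ≤ g i + g j) → dot g x ≡ 0ℚ →
  ∀ u → (∀ {j} → adj G u j ≡ true → g u + g j ≢ 0ℚ) → x u ≡ 0ℚ
EdgeCone-coordinate≡0 G g {x} (c , c-nonNeg , c-off , x≡Σc) g≥0 gx≡0 u g≢0-at-u =
  trans (x≡Σc u) (sumFin-zero (λ i → sumFin-zero (term≡0 i)))
  where
  weight : Fin _ → Fin _ → ℚ
  weight i j = c i j * (g i + g j)

  weight-nonNeg : ∀ i j → 0ℚ ≤ weight i j
  weight-nonNeg i j with adj G i j in ij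
  ... | true  = nonNegative⁻¹ (weight i j)
        {{nonNeg*nonNeg⇒nonNeg (c i j) {{nonNegative (c-nonNeg i j)}} (g i + g j) {{nonNegative (g≥0 ij)}}}}
  ... | false = ≤-reflexive (sym (p≡0⇒p*q≡0 (g i + g j) (c-off i j ij)))

  weight≡0 : ∀ i j → weight i j ≡ 0ℚ
  weight≡0 i j = sumFin-nonNeg≡0 (weight-nonNeg i)
    (sumFin-nonNeg≡0 (λ i → sumFin-nonNeg (weight-nonNeg i))
      (trans (sym (dot-edgeCombination g c x≡Σc)) gx≡0) i) j

  c≡0 : ∀ i j → (adj G i j ≡ true → g i + g j ≢ 0ℚ) → c i j ≡ 0ℚ
  c≡0 i j g≢0 with adj G i j in ij
  ... | true  = p*q≡0⇒p≡0 (c i j) (g≢0 refl) (weight≡0 i j)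
  ... | false = c-off i j ij

  term≡0 : ∀ i j → c i j * edgeVec i j u ≡ 0ℚ
  term≡0 i j with i ≟ u | j ≟ u
  ... | yes refl | _        = p≡0⇒p*q≡0 _ (c≡0 u j g≢0-at-u)
  ... | no _     | yes refl = p≡0⇒p*q≡0 _ (c≡0 i u g≢0-at-u′)
    where
    g≢0-at-u′ : adj G i u ≡ true → g i + g u ≢ 0ℚ
    g≢0-at-u′ iu = g≢0-at-u (trans (symm G u i) iu) ∘ trans (+-comm (g u) (g i))
  ... | no _     | no _     = *-zeroʳ (c i j)

ind-sub-nonNeg : ∀ {a b} → (a ≡ true → b ≡ true) → 0ℚ ≤ ind b - ind a
ind-sub-nonNeg {true}  a⇒b with refl ← a⇒b refl = ≤-refl
ind-sub-nonNeg {false} {true}  _ = nonNegative⁻¹ 1ℚ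
ind-sub-nonNeg {false} {false} _ = ≤-refl

ind-not-sub : ∀ a b → ind (not a) - ind (not b) ≡ ind b - ind a
ind-not-sub true  true  = refl
ind-not-sub true  false = refl
ind-not-sub false true  = refl
ind-not-sub false false = refl

ind-true-sub : ∀ a → ind true - ind a ≡ ind (not a)
ind-true-sub true  = refl
ind-true-sub false = refl

if-then-0 : ∀ b y → (if b then y else 0ℚ) ≡ ind b * y
if-then-0 true  y = sym (*-identityˡ y)
if-then-0 false y = sym (*-zeroˡ y)

HB-normal : ∀ {n} → Graph n → VSet n → Vecℚ n
HB-normal G B k = ind (N G B k) - ind (B k)

HB≐HypPlane : ∀ {n} (G : Graph n) (B : VSet n) → HB G B ≐ HypPlane (HB-normal G B)
HB≐HypPlane G B x =
    (λ Σ-equal → trans dot≡ΣN-ΣB (x≈y⇒x∙y⁻¹≈ε (sym Σ-equal)))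
  , (λ dot≡0 → sym (x∙y⁻¹≈ε⇒x≈y _ _ (trans (sym dot≡ΣN-ΣB) dot≡0)))
  where
  [a-b]*y≡a*y-b*y : ∀ a b y → (a - b) * y ≡ a * y - b * y
  [a-b]*y≡a*y-b*y = solve 3 (λ a b y → (a :- b) :* y := a :* y :- b :* y) refl

  term : ∀ k → HB-normal G B k * x k ≡ (if N G B k then x k else 0ℚ) - (if B k then x k else 0ℚ)
  term k = trans ([a-b]*y≡a*y-b*y (ind (N G B k)) (ind (B k)) (x k))
                 (sym (cong₂ _-_ (if-then-0 (N G B k) (x k)) (if-then-0 (B k) (x k))))

  dot≡ΣN-ΣB : dot (HB-normal G B) x ≡ sumOver (N G B) x - sumOver B x
  dot≡ΣN-ΣB = trans (sumFin-cong term) (sumFin-- (λ k → if N G B k then x k else 0ℚ) (λ k → if B k then x k else 0ℚ))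

He≐HypPlane : ∀ {n} (u : Fin n) → He u ≐ HypPlane (unit u)
He≐HypPlane u x = trans (dot-unitˡ u x) , trans (sym (dot-unitˡ u x))

∩-cong-HypPlane : ∀ {n} {P P′ Q : VPred n} (a b : Vecℚ n) → P ≐ HypPlane a → P′ ≐ HypPlane b →
  (∀ x → Q x → dot a x ≡ dot b x) → (P ∩ Q) ≐ (P′ ∩ Q)
∩-cong-HypPlane a b P≐a P′≐b a≈b x =
    (λ (Px , Qx) → proj₂ (P′≐b x) (trans (sym (a≈b x Qx)) (proj₁ (P≐a x) Px)) , Qx)
  , (λ (P′x , Qx) → proj₂ (P≐a x) (trans (a≈b x Qx) (proj₁ (P′≐b x) P′x)) , Qx)

⊆ᵥ-false : ∀ {n} {A V : VSet n} → A ⊆ᵥ V → ∀ {k} → V k ≡ false → A k ≡ false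
⊆ᵥ-false A⊆V {k} k∉V = ¬-not (λ k∈A → not-¬ (A⊆V k k∈A) k∉V)

IsBipartition-complᵥ : ∀ {n} {G : Graph n} {V : VSet n} → IsBipartition G V → IsBipartition G (complᵥ V)
IsBipartition-complᵥ bip i j ij = cong not (bip i j ij)

module Bipartite {n} (G : Graph n) {V : VSet n} (bip : IsBipartition G V) where

  edge-leaves : ∀ {i j} → adj G i j ≡ true → V i ≡ true → V j ≡ false
  edge-leaves {i} {j} ij i∈V = not-injective (trans (sym (bip i j ij)) i∈V)

  edge-enters : ∀ {i j} → adj G i j ≡ true → V i ≡ false → V j ≡ true
  edge-enters {i} {j} ij i∉V = not-injective (trans (sym (bip i j ij)) i∉V)

  edge-oriented : (P : Fin n → Fin n → Set) → (∀ {i j} → P i j → P j i) →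
    (∀ {i j} → adj G i j ≡ true → V i ≡ true → P i j) → ∀ {i j} → adj G i j ≡ true → P i j
  edge-oriented P P-sym P-from-V {i} {j} ij with V i in i∈V
  ... | true  = P-from-V ij i∈V
  ... | false = P-sym (P-from-V (trans (symm G j i) ij) (edge-enters ij i∈V))

  edge-sums-agree : (g h : Vecℚ n) → (∀ {i j} → adj G i j ≡ true → V i ≡ true → g i + g j ≡ h i + h j) →
    ∀ {i j} → adj G i j ≡ true → g i + g j ≡ h i + h j
  edge-sums-agree g h = edge-oriented (λ i j → g i + g j ≡ h i + h j)
    (λ {i} {j} gi+gj≡hi+hj → trans (+-comm (g j) (g i)) (trans gi+gj≡hi+hj (+-comm (h i) (h j))))

  module _ {B : VSet n} (B⊆V : B ⊆ᵥ V) where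

    N-outside : ∀ {j} → N G B j ≡ true → V j ≡ false
    N-outside j∈NB with N-elim G B j∈NB
    ... | i , i∈B , ij = edge-leaves ij (B⊆V i i∈B)

    HB-normal-edge : ∀ {i j} → adj G i j ≡ true → V i ≡ true →
      HB-normal G B i + HB-normal G B j ≡ ind (N G B j) - ind (B i)
    HB-normal-edge {i} {j} ij i∈V = begin
      (ind (N G B i) - ind (B i)) + (ind (N G B j) - ind (B j))
        ≡⟨ cong₂ (λ p q → (ind p - ind (B i)) + (ind (N G B j) - ind q))
                 (¬-not (λ i∈NB → not-¬ i∈V (N-outside i∈NB)))
                 (⊆ᵥ-false B⊆V (edge-leaves ij i∈V)) ⟩
      (0ℚ - ind (B i)) + (ind (N G B j) - 0ℚ)
        ≡⟨ [0-a]+[b-0]≡b-a (ind (B i)) (ind (N G B j)) ⟩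
      ind (N G B j) - ind (B i) ∎
      where
      [0-a]+[b-0]≡b-a : ∀ a b → (0ℚ - a) + (b - 0ℚ) ≡ b - a
      [0-a]+[b-0]≡b-a = solve 2 (λ a b → (con 0ℚ :- a) :+ (b :- con 0ℚ) := b :- a) refl

    HB-normal-edge≡1 : ∀ {i j} → adj G i j ≡ true → V i ≡ true → B i ≡ false → N G B j ≡ true →
      HB-normal G B i + HB-normal G B j ≡ 1ℚ
    HB-normal-edge≡1 ij i∈V i∉B j∈NB =
      trans (HB-normal-edge ij i∈V) (cong₂ (λ p q → ind p - ind q) j∈NB i∉B)

    HB-normal-nonNeg : ∀ {i j} → adj G i j ≡ true → 0ℚ ≤ HB-normal G B i + HB-normal G B j
    HB-normal-nonNeg = edge-oriented (λ i j → 0ℚ ≤ HB-normal G B i + HB-normal G B j)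
      (λ {i} {j} → subst (0ℚ ≤_) (+-comm (HB-normal G B i) (HB-normal G B j)))
      (λ {i} {j} ij i∈V → subst (0ℚ ≤_) (sym (HB-normal-edge ij i∈V))
                                  (ind-sub-nonNeg (λ i∈B → N-intro G B i∈B ij)))

∈-separates : ∀ {n} (V : VSet n) {i j} → V i ≡ true → V j ≡ false → i ≢ j
∈-separates V i∈V j∉V refl = not-¬ i∈V j∉V

⊆ᵥ-antisym : ∀ {n} {A B : VSet n} → A ⊆ᵥ B → B ⊆ᵥ A → A ≐ᵥ B
⊆ᵥ-antisym {A = A} {B} A⊆B B⊆A k with A k in k∈A | B k in k∈B
... | true  | true  = refl
... | false | false = refl
... | true  | false = ⊥-elim (not-¬ (A⊆B k k∈A) k∈B)
... | false | true  = ⊥-elim (not-¬ (B⊆A k k∈B) k∈A)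

module Facet {n} (G : Graph n) (conn : Connected G) {V1 : VSet n} (bip : IsBipartition G V1)
             {A : VSet n} (A⊆V1 : A ⊆ᵥ V1)
             {d} (dim-cone : HasDim (EdgeCone G) (suc d)) (dim-F : HasDim (HB G A ∩ EdgeCone G) d) where

  open Bipartite G bip

  F : VPred n
  F = HB G A ∩ EdgeCone G

  gA : Vecℚ n
  gA = HB-normal G A

  gA⊥F : ∀ x → F x → dot gA x ≡ 0ℚ
  gA⊥F x (x∈HA , _) = proj₁ (HB≐HypPlane G A x) x∈HA

  F⊆He : ∀ {u} → V1 u ≡ true → A u ≡ false → (∀ {j} → adj G u j ≡ true → N G A j ≡ true) → F ⊆ He u
  F⊆He {u} u∈V1 u∉A N[u]⊆N[A] x Fx@(_ , x∈cone) =
    EdgeCone-coordinate≡0 G gA x∈cone (HB-normal-nonNeg A⊆V1) (gA⊥F x Fx) u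
      (λ uj → p≡1⇒p≢0 (HB-normal-edge≡1 A⊆V1 uj u∈V1 u∉A (N[u]⊆N[A] uj)))

  unit⊥F : ∀ {u} → F ⊆ He u → ∀ x → F x → dot (unit u) x ≡ 0ℚ
  unit⊥F {u} F⊆Heu x Fx = trans (dot-unitˡ u x) (F⊆Heu x Fx)

  -- Otherwise e_u and g would be independent on the cone, as witnessed by an edge at u
  -- (one exists by connectedness) and the edge s–t.
  normal-vanishes-avoiding : ∀ {u} → F ⊆ He u → (g : Vecℚ n) → (∀ x → F x → dot g x ≡ 0ℚ) →
    ∀ {s t} → adj G s t ≡ true → u ≢ s → u ≢ t → dot g (edgeVec s t) ≡ 0ℚ
  normal-vanishes-avoiding {u} F⊆Heu g g⊥F {s} {t} st u≢s u≢t with Reach-neighbour (conn u s) u≢s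
  ... | j , uj = decidable-stable (dot g (edgeVec s t) ≟ℚ 0ℚ) λ g-st≢0 →
    facet-normals-dependent (λ _ → proj₂) dim-cone dim-F (unit u) g (unit⊥F F⊆Heu) g⊥F
      (edgeVec∈EdgeCone G uj) (edgeVec∈EdgeCone G st)
      (p≡1⇒p≢0 (dot-unit-edgeVec (adj⇒≢ G uj))) (dot-unit-edgeVec-avoiding u≢s u≢t) g-st≢0

  module N[A]≐V2 (N[A]≐V2 : N G A ≐ᵥ complᵥ V1) {i₀} (i₀∈V1 : V1 i₀ ≡ true) (i₀∉A : A i₀ ≡ false) where

    V1∖A⊆He : ∀ {u} → V1 u ≡ true → A u ≡ false → F ⊆ He u
    V1∖A⊆He u∈V1 u∉A = F⊆He u∈V1 u∉A (λ {j} uj → trans (N[A]≐V2 j) (cong not (edge-leaves uj u∈V1)))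

    V1∖A≡i₀ : ∀ {v} → V1 v ≡ true → A v ≡ false → i₀ ≡ v
    V1∖A≡i₀ {v} v∈V1 v∉A with i₀ ≟ v
    ... | yes i₀≡v = i₀≡v
    ... | no i₀≢v with Reach-neighbour (conn v i₀) (i₀≢v ∘ sym)
    ...   | w , vw = ⊥-elim (p≡1⇒p≢0 (dot-unit-edgeVec (adj⇒≢ G vw)) eᵥ-vw≡0)
      where
      eᵥ-vw≡0 : dot (unit v) (edgeVec v w) ≡ 0ℚ
      eᵥ-vw≡0 = normal-vanishes-avoiding (V1∖A⊆He i₀∈V1 i₀∉A) (unit v) (unit⊥F (V1∖A⊆He v∈V1 v∉A))
                  vw i₀≢v (∈-separates V1 i₀∈V1 (edge-leaves vw v∈V1))

    A-on-V1 : ∀ {k} → V1 k ≡ true → A k ≡ not (does (i₀ ≟ k))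
    A-on-V1 {k} k∈V1 with i₀ ≟ k
    ... | yes refl = i₀∉A
    ... | no i₀≢k  = ¬-not (i₀≢k ∘ V1∖A≡i₀ k∈V1)

    A≐V1∖i₀ : A ≐ᵥ (V1 ∖ᵥ singleᵥ i₀)
    A≐V1∖i₀ k with V1 k in k∈V1
    ... | true  = A-on-V1 k∈V1
    ... | false = ⊆ᵥ-false A⊆V1 k∈V1

    gA≈unit : ∀ {i j} → adj G i j ≡ true → gA i + gA j ≡ unit i₀ i + unit i₀ j
    gA≈unit = edge-sums-agree gA (unit i₀) λ {i} {j} ij i∈V1 → begin
      gA i + gA j                              ≡⟨ HB-normal-edge A⊆V1 ij i∈V1 ⟩
      ind (N G A j) - ind (A i)                ≡⟨ cong₂ (λ p q → ind p - ind q)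
                                                    (trans (N[A]≐V2 j) (cong not (edge-leaves ij i∈V1)))
                                                    (A-on-V1 i∈V1) ⟩
      ind true - ind (not (does (i₀ ≟ i)))     ≡⟨ ind-true-sub _ ⟩
      ind (not (not (does (i₀ ≟ i))))          ≡⟨ cong ind (not-involutive _) ⟩
      unit i₀ i                                ≡⟨ sym (+-identityʳ _) ⟩
      unit i₀ i + 0ℚ                           ≡⟨ cong (unit i₀ i +_)
                                                    (sym (unit-≢ (∈-separates V1 i₀∈V1 (edge-leaves ij i∈V1)))) ⟩
      unit i₀ i + unit i₀ j                    ∎

    F≐He : F ≐ (He i₀ ∩ EdgeCone G)
    F≐He = ∩-cong-HypPlane gA (unit i₀) (HB≐HypPlane G A) (He≐HypPlane i₀) (λ x x∈cone → EdgeCone-dot-cong G gA (unit i₀) gA≈unit x∈cone)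

  module N[A]⊊V2 {b} (b∉V1 : V1 b ≡ false) (b∉N[A] : N G A b ≡ false) where

    module V2 = Bipartite G (IsBipartition-complᵥ {G = G} {V = V1} bip)

    B : VSet n
    B = complᵥ V1 ∖ᵥ N G A

    B⊆V2 : B ⊆ᵥ complᵥ V1
    B⊆V2 k = ∧-conicalˡ (not (V1 k)) (not (N G A k))

    gB : Vecℚ n
    gB = HB-normal G B

    N[B]⊆V1∖A : N G B ⊆ᵥ (V1 ∖ᵥ A)
    N[B]⊆V1∖A k k∈N[B] with N-elim G B k∈N[B]
    ... | j , j∈B , jk = cong₂ _∧_ k∈V1 (cong not k∉A)
      where
      k∈V1 : V1 k ≡ true
      k∈V1 = edge-enters jk (not-injective (∧-conicalˡ _ _ j∈B))
      k∉A : A k ≡ false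
      k∉A = ¬-not (λ k∈A → not-¬ (N-intro G A k∈A (trans (symm G k j) jk)) (not-injective (∧-conicalʳ _ _ j∈B)))

    -- A vertex v ∈ V1 ∖ A outside N(B) has all its neighbours in N(A), so F ⊆ H_{e_v}. A walk from v
    -- to b leaves A ∪ N(A) ∪ {v}, necessarily along an edge from s ∈ N(A) to t ∈ V1 ∖ A with t ≠ v;
    -- gA is 1 on that edge, yet it vanishes on edges avoiding v.
    V1∖A⊆N[B] : ∀ {v} → V1 v ≡ true → A v ≡ false → N G B v ≡ true
    V1∖A⊆N[B] {v} v∈V1 v∉A = ¬-not λ v∉N[B] →
      leaving-edge-impossible v∉N[B] (Reach-exit P (conn v b) P[v] P[b])
      where
      P : VSet n
      P k = does (v ≟ k) ∨ (A k ∨ N G A k)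

      P[v] : P v ≡ true
      P[v] = cong (_∨ (A v ∨ N G A v)) (dec-true (v ≟ v) refl)

      P[b] : P b ≡ false
      P[b] = cong₂ _∨_ (dec-false (v ≟ b) (∈-separates V1 v∈V1 b∉V1))
                       (cong₂ _∨_ (⊆ᵥ-false A⊆V1 b∉V1) b∉N[A])

      N[v]⊆N[A] : N G B v ≡ false → ∀ {j} → adj G v j ≡ true → N G A j ≡ true
      N[v]⊆N[A] v∉N[B] {j} vj = ¬-not λ j∉N[A] →
        not-¬ (N-intro G B (cong₂ (λ p q → not p ∧ not q) (edge-leaves vj v∈V1) j∉N[A]) (trans (symm G j v) vj)) v∉N[B]

      P-false : ∀ {k} → P k ≡ false → v ≢ k × A k ≡ false × N G A k ≡ false
      P-false {k} Pk≡false =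
          (λ v≡k → not-¬ (dec-true (v ≟ k) v≡k) (∨-conicalˡ (does (v ≟ k)) (A k ∨ N G A k) Pk≡false))
        , ∨-conicalˡ (A k) (N G A k) A∨N[A]
        , ∨-conicalʳ (A k) (N G A k) A∨N[A]
        where A∨N[A] = ∨-conicalʳ (does (v ≟ k)) (A k ∨ N G A k) Pk≡false

      leaving-edge-impossible : N G B v ≡ false → (∃₂ λ s t → adj G s t ≡ true × P s ≡ true × P t ≡ false) → ⊥
      leaving-edge-impossible v∉N[B] (s , t , st , P[s] , P[t]) with P-false P[t] | v ≟ s | A s in s∈A
      ... | _ , _ , t∉N[A] | yes refl | _     = not-¬ (N[v]⊆N[A] v∉N[B] st) t∉N[A]
      ... | _ , _ , t∉N[A] | no _     | true  = not-¬ (N-intro G A s∈A st) t∉N[A]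
      ... | v≢t , t∉A , _  | no v≢s   | false = p≡1⇒p≢0 gA-ts≡1 gA-ts≡0
        where
        ts : adj G t s ≡ true
        ts = trans (symm G t s) st
        gA-ts≡1 : dot gA (edgeVec t s) ≡ 1ℚ
        gA-ts≡1 = trans (dot-edgeVec gA t s)
          (HB-normal-edge≡1 A⊆V1 ts (edge-enters st (N-outside A⊆V1 P[s])) t∉A P[s])
        gA-ts≡0 : dot gA (edgeVec t s) ≡ 0ℚ
        gA-ts≡0 = normal-vanishes-avoiding (F⊆He v∈V1 v∉A (N[v]⊆N[A] v∉N[B])) gA gA⊥F ts v≢t v≢s

    N[B]≐V1∖A : N G B ≐ᵥ (V1 ∖ᵥ A)
    N[B]≐V1∖A = ⊆ᵥ-antisym N[B]⊆V1∖A
      (λ k k∈V1∖A → V1∖A⊆N[B] (∧-conicalˡ _ _ k∈V1∖A) (not-injective (∧-conicalʳ _ _ k∈V1∖A)))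

    gA≈gB : ∀ {i j} → adj G i j ≡ true → gA i + gA j ≡ gB i + gB j
    gA≈gB = edge-sums-agree gA gB λ {i} {j} ij i∈V1 → begin
      gA i + gA j                          ≡⟨ HB-normal-edge A⊆V1 ij i∈V1 ⟩
      ind (N G A j) - ind (A i)            ≡⟨ sym (ind-not-sub (A i) (N G A j)) ⟩
      ind (not (A i)) - ind (not (N G A j)) ≡⟨ cong₂ (λ p q → ind p - ind q)
                                                (sym (trans (N[B]≐V1∖A i) (cong (_∧ not (A i)) i∈V1)))
                                                (sym (cong (λ p → not p ∧ not (N G A j)) (edge-leaves ij i∈V1))) ⟩
      ind (N G B i) - ind (B j)            ≡⟨ sym (V2.HB-normal-edge B⊆V2 (trans (symm G j i) ij)
                                                  (cong not (edge-leaves ij i∈V1))) ⟩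
      gB j + gB i                          ≡⟨ +-comm (gB j) (gB i) ⟩
      gB i + gB j                          ∎

    F≐HB : F ≐ (HB G B ∩ EdgeCone G)
    F≐HB = ∩-cong-HypPlane gA gB (HB≐HypPlane G A) (HB≐HypPlane G B)
      (λ x x∈cone → EdgeCone-dot-cong G gA gB gA≈gB x∈cone)

lemma4p4 : ∀ {n : ℕ} (G : Graph n) (V1 : VSet n) → Connected G → IsBipartition G V1 →
    (A : VSet n) → A ⊊ᵥ V1 →
    IsFacet (EdgeCone G) (HB G A ∩ EdgeCone G) →
    ((N G A ≐ᵥ complᵥ V1) →
       ∃ λ i → (i ∈ᵥ V1) × (A ≐ᵥ (V1 ∖ᵥ singleᵥ i)) ×
         ((HB G A ∩ EdgeCone G) ≐ (He i ∩ EdgeCone G)))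
    ×
    ((N G A ⊊ᵥ complᵥ V1) →
       ((HB G A ∩ EdgeCone G) ≐ (HB G (complᵥ V1 ∖ᵥ N G A) ∩ EdgeCone G)) ×
       (N G (complᵥ V1 ∖ᵥ N G A) ≐ᵥ (V1 ∖ᵥ A)))
lemma4p4 G V1 conn bip A (A⊆V1 , i₀ , i₀∈V1 , i₀∉A) (_ , _ , dim-cone , dim-F) =
    (λ N[A]≐V2 → let open N[A]≐V2 N[A]≐V2 i₀∈V1 i₀∉A in i₀ , i₀∈V1 , A≐V1∖i₀ , F≐He)
  , (λ (_ , b , b∈V2 , b∉N[A]) → let open N[A]⊊V2 (not-injective b∈V2) b∉N[A] in F≐HB , N[B]≐V1∖A)
  where open Facet G conn bip A⊆V1 dim-cone dim-F
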